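{- Let $X,C$ be finite sets, $\mathcal{A}^*\in\mathsf{Sub}_r(\mathbf{F}(X)^*\times\mathbf{F}(C)^*)$, and let $\mathcal{B}_1^*,\dots,\mathcal{B}_n^*\in\mathsf{Sub}_r(\mathbf{F}(X)^*)$ be a $\forall_{\mathbf{F}(C)^*}$-factorization of $\mathcal{A}^*$. Then $$U^{svr}_E(\mathcal{A},C)\simeq U_E(\mathcal{B}_1)\cup\dots\cup U_E(\mathcal{B}_n)$$ as preordered sets; that is, a homomorphism $\sigma:\mathbf{F}(X)\to\mathbf{F}(X')$ is a $C$-unifier of $(\mathcal{A},C)$ if and only if it is a unifier of $\mathcal{B}_i$ for some $i$, and both sets carry the same comparison preorder.
   Context: $E$ is an equational theory in a functional signature with at least one constant; the variety of $E$-algebras is assumed (standing assumption) to have (IT) (whenever $f:\mathcal{A}\to\mathcal{B}$ is a homomorphism and $g:\mathcal{A}\to\mathcal{C}$ injective, there exist a homomorphism $h:\mathcal{C}\to\mathcal{E}$ and injective $h':\mathcal{B}\to\mathcal{E}$ with $h'f=hg$), to be coherent (finitely generated subalgebras of finitely presented algebras are finitely presented), and to have the $\forall$-factorization property. $\mathsf{Alg}^{op}_{fp}(E)$ is the opposite of the category of finitely presented $E$-algebras; $\mathcal{A}^*$, $\sigma^*$ denote algebras/homomorphisms viewed there; $\mathbf{F}(Y)$ is the free algebra on a finite set $Y$. $\mathsf{Sub}_r(V)$ is the poset of regular subobjects of $V$ (dually: finitely presented quotients), $f^{ -1}$ pullback along $f$, $1$ the maximum subobject. For $T\in\mathsf{Sub}_r(V\times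 W)$, $B_1,\dots,B_n\in\mathsf{Sub}_r(W)$ form a $\forall_V$-factorization of $T$ if $\pi_W^{ -1}(B_i)\le T$ for all $i$ and every $D\in\mathsf{Sub}_r(W)$ with $\pi_W^{ -1}(D)\le T$ satisfies $D\le B_i$ for some $i$ (here $W=\mathbf{F}(X)^*$, $V=\mathbf{F}(C)^*$); the $\forall$-factorization property says such factorizations always exist. $U^{svr}_E(\mathcal{A},C)$ is the set of $C$-unifiers of $(\mathcal{A},C)$: homomorphisms $\sigma:\mathbf{F}(X)\to\mathbf{F}(Z)$ ($Z$ finite) such that $\sigma^*\times 1$ factors through $\mathcal{A}^*\hookrightarrow\mathbf{F}(X)^*\times\mathbf{F}(C)^*$. For $\mathcal{B}^*\in\mathsf{Sub}_r(\mathbf{F}(X)^*)$, $U_E(\mathcal{B})$ is the set of unifiers of $\mathcal{B}$: homomorphisms $\sigma:\mathbf{F}(X)\to\mathbf{F}(Z)$ such that $\sigma^*$ factors through $\mathcal{B}^*\hookrightarrow\mathbf{F}(X)^*$ (i.e. $\sigma$ factors through the quotient $\mathbf{F}(X)\to\mathcal{B}$). On both sets, for $\sigma:\mathbf{F}(X)\to\mathbf{F}(Z)$ and $\gamma:\mathbf{F}(X)\to\mathbf{F}(W)$, $\sigma$ is more general than $\gamma$ if $k\circ\sigma=\gamma$ for some homomorphism $k:\mathbf{F}(Z)\to\mathbf{F}(W)$. -}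

module Defs where

open import Data.Nat using (ℕ)
open import Data.Fin using (Fin)
open import Data.Sum using (_⊎_; inj₁; inj₂; [_,_])
open import Data.Product using (Σ; _×_; _,_; proj₁; proj₂; ∃-syntax)
open import Data.List using (List; []; map)
open import Data.List.Membership.Propositional using (_∈_)
open import Data.List.Relation.Unary.All using (All)
open import Relation.Binary.PropositionalEquality using (_≡_)
open import Relation.Binary.Structures using (IsEquivalence)
open import Function using (_∘_)

record Signature : Set₁ where
  field
    Op    : Set
    arity : Op → ℕ

HasConstant : Signature → Set
HasConstant Sg = Σ (Signature.Op Sg) λ f → Signature.arity Sg f ≡ 0

module _ (Sg : Signature) where
  open Signature Sg

  data Term (V : Set) : Set where
    var : V → Term V
    op  : (f : Op) → (Fin (arity f) → Term V) → Term V

  evalWith : {V A : Set} → ((f : Op) → (Fin (arity f) → A) → A) → (V → A) → Term V → A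
  evalWith ⟦_⟧ ρ (var v)   = ρ v
  evalWith ⟦_⟧ ρ (op f ts) = ⟦ f ⟧ (λ i → evalWith ⟦_⟧ ρ (ts i))

  subst : {V W : Set} → (V → Term W) → Term V → Term W
  subst = evalWith op

  Eqn : Set → Set
  Eqn V = Term V × Term V

  substEqn : {V W : Set} → (V → Term W) → Eqn V → Eqn W
  substEqn σ (s , t) = subst σ s , subst σ t

  record Theory : Set₁ where
    field
      Ax    : Set
      nvars : Ax → ℕ
      lhs   : (a : Ax) → Term (Fin (nvars a))
      rhs   : (a : Ax) → Term (Fin (nvars a))

module _ {Sg : Signature} (E : Theory Sg) where
  open Signature Sg
  open Theory E

  -- Deriv H s t : the congruence on Term V generated by all substitution
  -- instances of the axioms of E together with the equations H (which are
  -- NOT instantiated: they are relations among the generators V).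
  -- Term V modulo Deriv [] is the free E-algebra F(V); modulo Deriv H it is
  -- the finitely presented quotient F(V)/⟨H⟩.
  data Deriv {V : Set} (H : List (Eqn Sg V)) : Term Sg V → Term Sg V → Set where
    hyp   : ∀ {s t} → (s , t) ∈ H → Deriv H s t
    ax    : (a : Ax) (ρ : Fin (nvars a) → Term Sg V) →
            Deriv H (subst Sg ρ (lhs a)) (subst Sg ρ (rhs a))
    refl  : ∀ {s} → Deriv H s s
    sym   : ∀ {s t} → Deriv H s t → Deriv H t s
    trans : ∀ {s t u} → Deriv H s t → Deriv H t u → Deriv H s u
    cong  : (f : Op) {ts us : Fin (arity f) → Term Sg V} →
            (∀ i → Deriv H (ts i) (us i)) → Deriv H (op f ts) (op f us)

  Entails : {V : Set} → List (Eqn Sg V) → List (Eqn Sg V) → Set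
  Entails H S = All (λ e → Deriv H (proj₁ e) (proj₂ e)) S

  -- Regular subobjects of F(Fin x)^* in Alg_fp^op are finitely presented
  -- quotients F(Fin x)/⟨S⟩, given by a finite list S of equations over Fin x.
  -- B ≤ B' as subobjects  iff  F(x) → B factors through F(x) → B'
  --                       iff  Entails B B'.
  -- F(X)^* × F(C)^* = F(X ⊎ C)^*, and π_W : F(X)^* × F(C)^* → F(X)^* is
  -- dual to the inclusion F(X) → F(X ⊎ C); the pullback π_W^{-1}(B)
  -- is the quotient of F(X ⊎ C) by the image of the equations of B.

  liftX : {x c : ℕ} → Eqn Sg (Fin x) → Eqn Sg (Fin x ⊎ Fin c)
  liftX = substEqn Sg (var ∘ inj₁)

  IsForallFactorization : (x c : ℕ) → List (Eqn Sg (Fin x ⊎ Fin c)) →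
                          (n : ℕ) → (Fin n → List (Eqn Sg (Fin x))) → Set
  IsForallFactorization x c A n B =
    (∀ i → Entails (map liftX (B i)) A) ×
    (∀ (D : List (Eqn Sg (Fin x))) → Entails (map liftX D) A → ∃[ i ] Entails D (B i))

  ForallFactorizationProperty : Set
  ForallFactorizationProperty =
    ∀ (x c : ℕ) (A : List (Eqn Sg (Fin x ⊎ Fin c))) →
      Σ ℕ λ n → Σ (Fin n → List (Eqn Sg (Fin x))) λ B → IsForallFactorization x c A n B

  -- Unifiers.  A homomorphism σ : F(Fin x) → F(Fin z) is given by the
  -- images of the generators (a substitution).

  -- σ is a unifier of B (σ factors through F(x) → F(x)/⟨B⟩)
  Unifier : {x z : ℕ} → List (Eqn Sg (Fin x)) → (Fin x → Term Sg (Fin z)) → Set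
  Unifier B σ = All (λ e → Deriv [] (subst Sg σ (proj₁ e)) (subst Sg σ (proj₂ e))) B

  -- σ is a C-unifier of (A, C): σ^* × 1 factors through A^*, i.e.
  -- σ ⊎ id : F(X ⊎ C) → F(Z ⊎ C) factors through F(X ⊎ C) → F(X ⊎ C)/⟨A⟩
  CUnifier : {x c z : ℕ} → List (Eqn Sg (Fin x ⊎ Fin c)) → (Fin x → Term Sg (Fin z)) → Set
  CUnifier {x} {c} {z} A σ =
    All (λ e → Deriv [] (subst Sg τ (proj₁ e)) (subst Sg τ (proj₂ e))) A
    where
      τ : Fin x ⊎ Fin c → Term Sg (Fin z ⊎ Fin c)
      τ = [ subst Sg (var ∘ inj₁) ∘ σ , var ∘ inj₂ ]

  MoreGeneral : {x z w : ℕ} → (Fin x → Term Sg (Fin z)) → (Fin x → Term Sg (Fin w)) → Set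
  MoreGeneral {z = z} {w} σ γ =
    Σ (Fin z → Term Sg (Fin w)) λ k → ∀ v → Deriv [] (subst Sg k (σ v)) (γ v)

  record Algebra : Set₁ where
    field
      Carrier : Set
      _≈_     : Carrier → Carrier → Set
      isEquiv : IsEquivalence _≈_
      ⟦_⟧     : (f : Op) → (Fin (arity f) → Carrier) → Carrier
      ⟦⟧-cong : (f : Op) {as bs : Fin (arity f) → Carrier} →
                (∀ i → as i ≈ bs i) → ⟦ f ⟧ as ≈ ⟦ f ⟧ bs
      sat     : (a : Ax) (ρ : Fin (nvars a) → Carrier) →
                evalWith Sg ⟦_⟧ ρ (lhs a) ≈ evalWith Sg ⟦_⟧ ρ (rhs a)

  open Algebra

  record Hom (A B : Algebra) : Set where
    field
      fun      : Carrier A → Carrier B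
      fun-cong : ∀ {a b} → _≈_ A a b → _≈_ B (fun a) (fun b)
      preserve : (f : Op) (as : Fin (arity f) → Carrier A) →
                 _≈_ B (fun (⟦_⟧ A f as)) (⟦_⟧ B f (fun ∘ as))

  open Hom

  InjectiveHom : {A B : Algebra} → Hom A B → Set
  InjectiveHom {A} {B} h = ∀ a b → _≈_ B (fun h a) (fun h b) → _≈_ A a b

  IT : Set₁
  IT = ∀ (A B C : Algebra) (f : Hom A B) (g : Hom A C) → InjectiveHom g →
       Σ Algebra λ D → Σ (Hom C D) λ h → Σ (Hom B D) λ h' →
         InjectiveHom h' × (∀ a → _≈_ D (fun h' (fun f a)) (fun h (fun g a)))

  record Iso (A B : Algebra) : Set where
    field
      to      : Hom A B
      from    : Hom B A
      from-to : ∀ a → _≈_ A (fun from (fun to a)) a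
      to-from : ∀ b → _≈_ B (fun to (fun from b)) b

  Presented : (k : ℕ) → List (Eqn Sg (Fin k)) → Algebra
  Presented k S = record
    { Carrier = Term Sg (Fin k)
    ; _≈_     = Deriv S
    ; isEquiv = record { refl = refl ; sym = sym ; trans = trans }
    ; ⟦_⟧     = op
    ; ⟦⟧-cong = cong
    ; sat     = ax
    }

  FinitelyPresented : Algebra → Set
  FinitelyPresented A = Σ ℕ λ k → Σ (List (Eqn Sg (Fin k))) λ S → Iso (Presented k S) A

  module _ (A : Algebra) (m : ℕ) (g : Fin m → Carrier A) where
    private
      module A = Algebra A
      module EqA = IsEquivalence A.isEquiv

      SC : Set
      SC = Σ A.Carrier λ a → Σ (Term Sg (Fin m)) λ t → a A.≈ evalWith Sg A.⟦_⟧ g t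

      sop : (f : Op) → (Fin (arity f) → SC) → SC
      sop f xs = A.⟦ f ⟧ (proj₁ ∘ xs) , op f (λ i → proj₁ (proj₂ (xs i))) ,
                 A.⟦⟧-cong f (λ i → proj₂ (proj₂ (xs i)))

      evlem : ∀ {V} (ρ : V → SC) (t : Term Sg V) →
              proj₁ (evalWith Sg sop ρ t) A.≈ evalWith Sg A.⟦_⟧ (proj₁ ∘ ρ) t
      evlem ρ (var v)   = EqA.refl
      evlem ρ (op f ts) = A.⟦⟧-cong f (λ i → evlem ρ (ts i))

    Generated : Algebra
    Generated = record
      { Carrier = SC
      ; _≈_     = λ a b → proj₁ a A.≈ proj₁ b
      ; isEquiv = record { refl = EqA.refl ; sym = EqA.sym ; trans = EqA.trans }
      ; ⟦_⟧     = sop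
      ; ⟦⟧-cong = λ f eqs → A.⟦⟧-cong f eqs
      ; sat     = λ a ρ → EqA.trans (evlem ρ (lhs a))
                           (EqA.trans (A.sat a (proj₁ ∘ ρ)) (EqA.sym (evlem ρ (rhs a))))
      }

  Coherent : Set₁
  Coherent = ∀ (A : Algebra) → FinitelyPresented A →
             ∀ (m : ℕ) (g : Fin m → Carrier A) → FinitelyPresented (Generated A m g)

-- If σ unifies some Bᵢ then σ ⊎ id unifies A, because π⁻¹(Bᵢ) ≤ A.  Conversely, let σ be a
-- C-unifier.  By coherence the image of σ : F(X) → F(Z) is finitely presented, say by relations D,
-- so that σ embeds F(X)/⟨D⟩ into F(Z).  Amalgamating this embedding with F(X)/⟨D⟩ → F(X ⊎ C)/⟨D⟩
-- by (IT) yields an injective homomorphism out of F(X ⊎ C)/⟨D⟩ through which σ ⊎ id factors; hence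
-- every equation of A holds in F(X ⊎ C)/⟨D⟩, i.e. π⁻¹(D) ≤ A.  By maximality D ≤ Bᵢ for some i,
-- and σ, which unifies D, unifies Bᵢ.
module Submission where

open import Defs
open import Data.Nat using (ℕ)
open import Data.Fin using (Fin)
open import Data.Sum using (_⊎_; inj₁; inj₂; [_,_])
open import Data.Product using (_,_; proj₁; proj₂; ∃-syntax; map₂)
open import Data.List using (List; []; map; tabulate; _++_)
open import Data.List.Membership.Propositional.Properties using (∈-map⁺; ∈-tabulate⁺; ∈-++⁺ˡ; ∈-++⁺ʳ)
open import Data.List.Relation.Unary.All as All using (All; [])
open import Data.List.Relation.Unary.All.Properties using (map⁺; tabulate⁺; ++⁺)
open import Relation.Binary.Bundles using (Setoid)
open import Relation.Binary.Structures using (IsEquivalence)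
open import Function using (_∘_)
open import Function.Bundles using (_⇔_; mk⇔)
import Relation.Binary.Reasoning.Setoid as SetoidReasoning

module _ {Sg : Signature} (E : Theory Sg) where
  open Signature Sg
  open Theory E
  open Algebra using (Carrier)
  open Hom using (fun)

  TermAlgebra : (V : Set) → List (Eqn Sg V) → Algebra E
  TermAlgebra V S = record
    { Carrier = Term Sg V
    ; _≈_     = Deriv E S
    ; isEquiv = record { refl = refl ; sym = sym ; trans = trans }
    ; ⟦_⟧     = op
    ; ⟦⟧-cong = cong
    ; sat     = ax
    }

  setoid : Algebra E → Setoid _ _
  setoid 𝒜 = record { isEquivalence = Algebra.isEquiv 𝒜 }

  module _ (𝒜 : Algebra E) where
    open Algebra 𝒜 hiding (Carrier)
    private module ≈ = IsEquivalence isEquiv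

    eval : {V : Set} → (V → Carrier 𝒜) → Term Sg V → Carrier 𝒜
    eval = evalWith Sg ⟦_⟧

    Satisfies : {V : Set} → (V → Carrier 𝒜) → List (Eqn Sg V) → Set
    Satisfies ρ H = All (λ e → eval ρ (proj₁ e) ≈ eval ρ (proj₂ e)) H

    eval-cong : {V : Set} {ρ ρ' : V → Carrier 𝒜} → (∀ v → ρ v ≈ ρ' v) →
                ∀ t → eval ρ t ≈ eval ρ' t
    eval-cong ρ≈ρ' (var v)   = ρ≈ρ' v
    eval-cong ρ≈ρ' (op f ts) = ⟦⟧-cong f (λ i → eval-cong ρ≈ρ' (ts i))

    eval-subst : {V W : Set} (ρ : W → Carrier 𝒜) (θ : V → Term Sg W) (t : Term Sg V) →
                 eval ρ (subst Sg θ t) ≈ eval (eval ρ ∘ θ) t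
    eval-subst ρ θ (var v)   = ≈.refl
    eval-subst ρ θ (op f ts) = ⟦⟧-cong f (λ i → eval-subst ρ θ (ts i))

    eval-sound : {V : Set} {H : List (Eqn Sg V)} (ρ : V → Carrier 𝒜) → Satisfies ρ H →
                 ∀ {s t} → Deriv E H s t → eval ρ s ≈ eval ρ t
    eval-sound ρ ρ⊨H (hyp e∈H)    = All.lookup ρ⊨H e∈H
    eval-sound ρ ρ⊨H (ax a ρ')    = begin
      eval ρ (subst Sg ρ' (lhs a)) ≈⟨ eval-subst ρ ρ' (lhs a) ⟩
      eval (eval ρ ∘ ρ') (lhs a)   ≈⟨ sat a (eval ρ ∘ ρ') ⟩
      eval (eval ρ ∘ ρ') (rhs a)   ≈⟨ eval-subst ρ ρ' (rhs a) ⟨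
      eval ρ (subst Sg ρ' (rhs a)) ∎
      where open SetoidReasoning (setoid 𝒜)
    eval-sound ρ ρ⊨H refl         = ≈.refl
    eval-sound ρ ρ⊨H (sym d)      = ≈.sym (eval-sound ρ ρ⊨H d)
    eval-sound ρ ρ⊨H (trans d d') = ≈.trans (eval-sound ρ ρ⊨H d) (eval-sound ρ ρ⊨H d')
    eval-sound ρ ρ⊨H (cong f ds)  = ⟦⟧-cong f (λ i → eval-sound ρ ρ⊨H (ds i))

    satisfies-entailed : {V : Set} {H S : List (Eqn Sg V)} (ρ : V → Carrier 𝒜) →
                         Satisfies ρ H → Entails E H S → Satisfies ρ S
    satisfies-entailed ρ ρ⊨H = All.map (eval-sound ρ ρ⊨H)

  module _ {𝒜 𝓑 : Algebra E} (h : Hom E 𝒜 𝓑) where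
    private module 𝓑 = Algebra 𝓑
    private module 𝓑≈ = IsEquivalence 𝓑.isEquiv

    hom-eval : {V : Set} (ρ : V → Carrier 𝒜) (t : Term Sg V) →
               fun h (eval 𝒜 ρ t) 𝓑.≈ eval 𝓑 (fun h ∘ ρ) t
    hom-eval ρ (var v)   = 𝓑≈.refl
    hom-eval ρ (op f ts) = 𝓑≈.trans (Hom.preserve h f _) (𝓑.⟦⟧-cong f (λ i → hom-eval ρ (ts i)))

  module _ {V : Set} {S : List (Eqn Sg V)} {𝓑 : Algebra E} (h : Hom E (TermAlgebra V S) 𝓑) where
    private module 𝓑 = Algebra 𝓑
    private module 𝓑≈ = IsEquivalence 𝓑.isEquiv

    hom-term : (t : Term Sg V) → fun h t 𝓑.≈ eval 𝓑 (fun h ∘ var) t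
    hom-term (var v)   = 𝓑≈.refl
    hom-term (op f ts) = 𝓑≈.trans (Hom.preserve h f ts) (𝓑.⟦⟧-cong f (λ i → hom-term (ts i)))

  idHom : (𝒜 : Algebra E) → Hom E 𝒜 𝒜
  idHom 𝒜 = record
    { fun = λ a → a ; fun-cong = λ a≈b → a≈b ; preserve = λ _ _ → IsEquivalence.refl (Algebra.isEquiv 𝒜) }

  presented-isFinitelyPresented : (k : ℕ) (S : List (Eqn Sg (Fin k))) → FinitelyPresented E (Presented E k S)
  presented-isFinitelyPresented k S = k , S , record
    { to = idHom 𝒫 ; from = idHom 𝒫 ; from-to = λ _ → refl ; to-from = λ _ → refl }
    where 𝒫 = Presented E k S

  generated-inclusion : (𝒜 : Algebra E) (m : ℕ) (g : Fin m → Carrier 𝒜) → Hom E (Generated E 𝒜 m g) 𝒜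
  generated-inclusion 𝒜 m g = record
    { fun = proj₁ ; fun-cong = λ a≈b → a≈b ; preserve = λ _ _ → IsEquivalence.refl (Algebra.isEquiv 𝒜) }

  module _ {V W : Set} {K : List (Eqn Sg W)} where

    subst-cong : {θ θ' : V → Term Sg W} → (∀ v → Deriv E K (θ v) (θ' v)) →
                 ∀ t → Deriv E K (subst Sg θ t) (subst Sg θ' t)
    subst-cong = eval-cong (TermAlgebra W K)

    subst-subst : {U : Set} (θ : V → Term Sg W) (η : U → Term Sg V) (t : Term Sg U) →
                  Deriv E K (subst Sg θ (subst Sg η t)) (subst Sg (subst Sg θ ∘ η) t)
    subst-subst = eval-subst (TermAlgebra W K)

    subst-sound : {H : List (Eqn Sg V)} (θ : V → Term Sg W) → Satisfies (TermAlgebra W K) θ H →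
                  ∀ {s t} → Deriv E H s t → Deriv E K (subst Sg θ s) (subst Sg θ t)
    subst-sound = eval-sound (TermAlgebra W K)

    substHom : {H : List (Eqn Sg V)} (θ : V → Term Sg W) → Satisfies (TermAlgebra W K) θ H →
               Hom E (TermAlgebra V H) (TermAlgebra W K)
    substHom θ θ⊨H = record { fun = subst Sg θ ; fun-cong = subst-sound θ θ⊨H ; preserve = λ _ _ → refl }

  withParameters : {x c z : ℕ} → (Fin x → Term Sg (Fin z)) → Fin x ⊎ Fin c → Term Sg (Fin z ⊎ Fin c)
  withParameters σ = [ subst Sg (var ∘ inj₁) ∘ σ , var ∘ inj₂ ]

  unifier⇒cunifier : {x c z : ℕ} {A : List (Eqn Sg (Fin x ⊎ Fin c))} {B : List (Eqn Sg (Fin x))}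
                     {σ : Fin x → Term Sg (Fin z)} →
                     Entails E (map (liftX E) B) A → Unifier E B σ → CUnifier E {c = c} A σ
  unifier⇒cunifier {x} {c} {z} {σ = σ} πB≤A σ⊨B =
    satisfies-entailed F τ (map⁺ (All.map (λ {e} → lift-equation (proj₁ e) (proj₂ e)) σ⊨B)) πB≤A
    where
    F : Algebra E
    F = TermAlgebra (Fin z ⊎ Fin c) []

    τ : Fin x ⊎ Fin c → Term Sg (Fin z ⊎ Fin c)
    τ = withParameters σ

    open SetoidReasoning (setoid F)

    lift-equation : ∀ s t → Deriv E [] (subst Sg σ s) (subst Sg σ t) →
                    Deriv E [] (subst Sg τ (subst Sg (var ∘ inj₁) s)) (subst Sg τ (subst Sg (var ∘ inj₁) t))
    lift-equation s t σs≈σt = begin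
      subst Sg τ (subst Sg (var ∘ inj₁) s)  ≈⟨ subst-subst τ (var ∘ inj₁) s ⟩
      subst Sg (subst Sg (var ∘ inj₁) ∘ σ) s ≈⟨ subst-subst (var ∘ inj₁) σ s ⟨
      subst Sg (var ∘ inj₁) (subst Sg σ s)  ≈⟨ subst-sound (var ∘ inj₁) [] σs≈σt ⟩
      subst Sg (var ∘ inj₁) (subst Sg σ t)  ≈⟨ subst-subst (var ∘ inj₁) σ t ⟩
      subst Sg (subst Sg (var ∘ inj₁) ∘ σ) t ≈⟨ subst-subst τ (var ∘ inj₁) t ⟨
      subst Sg τ (subst Sg (var ∘ inj₁) t)  ∎

  -- σ embeds F(X)/⟨relations⟩ into F(Z).
  record KernelPresentation {x z : ℕ} (σ : Fin x → Term Sg (Fin z)) : Set where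
    field
      relations : List (Eqn Sg (Fin x))
      unifies   : Unifier E relations σ
      reflects  : ∀ u v → Deriv E [] (subst Sg σ u) (subst Sg σ v) → Deriv E relations u v

  module _ (coh : Coherent E) {x z : ℕ} (σ : Fin x → Term Sg (Fin z)) where
    private
      F : Algebra E
      F = Presented E z []

      Image : Algebra E
      Image = Generated E F x σ

      imageOf : Term Sg (Fin x) → Carrier Image
      imageOf u = subst Sg σ u , u , refl

      image-eval : ∀ u → Deriv E [] (proj₁ (eval Image (imageOf ∘ var) u)) (subst Sg σ u)
      image-eval = hom-eval (generated-inclusion F x σ) (imageOf ∘ var)

      presentation : FinitelyPresented E Image
      presentation = coh F (presented-isFinitelyPresented z []) x σ

      k : ℕ
      k = proj₁ presentation

      S : List (Eqn Sg (Fin k))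
      S = proj₁ (proj₂ presentation)

      open Iso (proj₂ (proj₂ presentation))

      -- a σ-preimage of the element of the image named by each generator of F(k)/⟨S⟩
      preimage : Fin k → Term Sg (Fin x)
      preimage l = proj₁ (proj₂ (fun to (var l)))

      coordinates : Fin x → Term Sg (Fin k)
      coordinates j = fun from (imageOf (var j))

      relations : List (Eqn Sg (Fin x))
      relations = tabulate (λ j → var j , subst Sg preimage (coordinates j)) ++ map (substEqn Sg preimage) S

      σ-preimage : ∀ p → Deriv E [] (proj₁ (fun to p)) (subst Sg σ (subst Sg preimage p))
      σ-preimage p = begin
        proj₁ (fun to p)                          ≈⟨ hom-term to p ⟩
        proj₁ (eval Image (fun to ∘ var) p)       ≈⟨ hom-eval (generated-inclusion F x σ) (fun to ∘ var) p ⟩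
        subst Sg (proj₁ ∘ fun to ∘ var) p         ≈⟨ subst-cong (λ l → proj₂ (proj₂ (fun to (var l)))) p ⟩
        subst Sg (subst Sg σ ∘ preimage) p        ≈⟨ subst-subst σ preimage p ⟨
        subst Sg σ (subst Sg preimage p)          ∎
        where open SetoidReasoning (setoid F)

      σ-unifies : Unifier E relations σ
      σ-unifies = ++⁺ (tabulate⁺ λ j → trans (sym (to-from (imageOf (var j)))) (σ-preimage (coordinates j)))
                      (map⁺ (All.tabulate λ e∈S →
                        trans (sym (σ-preimage _)) (trans (Hom.fun-cong to (hyp e∈S)) (σ-preimage _))))

      preimage-respects : Satisfies (TermAlgebra (Fin x) relations) preimage S
      preimage-respects = All.tabulate λ e∈S → hyp (∈-++⁺ʳ _ (∈-map⁺ (substEqn Sg preimage) e∈S))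

      from-coordinates : ∀ u → Deriv E relations u (subst Sg preimage (subst Sg coordinates u))
      from-coordinates (var j)   = hyp (∈-++⁺ˡ (∈-tabulate⁺ j))
      from-coordinates (op f us) = cong f (λ i → from-coordinates (us i))

      coordinates-of-image : ∀ u → Deriv E S (fun from (imageOf u)) (subst Sg coordinates u)
      coordinates-of-image u = trans (Hom.fun-cong from (sym (image-eval u))) (hom-eval from (imageOf ∘ var) u)

      σ-reflects : ∀ u v → Deriv E [] (subst Sg σ u) (subst Sg σ v) → Deriv E relations u v
      σ-reflects u v σu≈σv = begin
        u                                            ≈⟨ from-coordinates u ⟩
        subst Sg preimage (subst Sg coordinates u)   ≈⟨ subst-sound preimage preimage-respects coordinates-agree ⟩
        subst Sg preimage (subst Sg coordinates v)   ≈⟨ from-coordinates v ⟨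
        v                                            ∎
        where
        open SetoidReasoning (setoid (TermAlgebra (Fin x) relations))
        coordinates-agree : Deriv E S (subst Sg coordinates u) (subst Sg coordinates v)
        coordinates-agree = trans (sym (coordinates-of-image u))
                                  (trans (Hom.fun-cong from σu≈σv) (coordinates-of-image v))

    kernelPresentation : KernelPresentation σ
    kernelPresentation = record { relations = relations ; unifies = σ-unifies ; reflects = σ-reflects }

  module _ {x c z : ℕ} {P : List (Eqn Sg (Fin x ⊎ Fin c))} {𝓔 : Algebra E}
           (σ : Fin x → Term Sg (Fin z))
           (h : Hom E (TermAlgebra (Fin z) []) 𝓔) (h' : Hom E (TermAlgebra (Fin x ⊎ Fin c) P) 𝓔)
           (agree : ∀ j → Algebra._≈_ 𝓔 (fun h' (var (inj₁ j))) (fun h (σ j))) where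
    private
      τ : Fin x ⊎ Fin c → Term Sg (Fin z ⊎ Fin c)
      τ = withParameters σ

      ρ : Fin z ⊎ Fin c → Carrier 𝓔
      ρ = [ fun h ∘ var , fun h' ∘ var ∘ inj₂ ]

      open SetoidReasoning (setoid 𝓔)

    hom-factors-through-withParameters : ∀ a → Algebra._≈_ 𝓔 (fun h' a) (eval 𝓔 ρ (subst Sg τ a))
    hom-factors-through-withParameters a = begin
      fun h' a                  ≈⟨ hom-term h' a ⟩
      eval 𝓔 (fun h' ∘ var) a   ≈⟨ eval-cong 𝓔 on-generators a ⟩
      eval 𝓔 (eval 𝓔 ρ ∘ τ) a   ≈⟨ eval-subst 𝓔 ρ τ a ⟨
      eval 𝓔 ρ (subst Sg τ a)   ∎
      where
      on-generators : ∀ v → Algebra._≈_ 𝓔 (fun h' (var v)) (eval 𝓔 ρ (τ v))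
      on-generators (inj₁ j) = begin
        fun h' (var (inj₁ j))                  ≈⟨ agree j ⟩
        fun h (σ j)                            ≈⟨ hom-term h (σ j) ⟩
        eval 𝓔 (fun h ∘ var) (σ j)             ≈⟨ eval-subst 𝓔 ρ (var ∘ inj₁) (σ j) ⟨
        eval 𝓔 ρ (subst Sg (var ∘ inj₁) (σ j)) ∎
      on-generators (inj₂ d) = IsEquivalence.refl (Algebra.isEquiv 𝓔)

    withParameters-reflects : InjectiveHom E h' →
                              ∀ s t → Deriv E [] (subst Sg τ s) (subst Sg τ t) → Deriv E P s t
    withParameters-reflects h'-injective s t τs≈τt = h'-injective s t (begin
      fun h' s                  ≈⟨ hom-factors-through-withParameters s ⟩
      eval 𝓔 ρ (subst Sg τ s)   ≈⟨ eval-sound 𝓔 ρ [] τs≈τt ⟩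
      eval 𝓔 ρ (subst Sg τ t)   ≈⟨ hom-factors-through-withParameters t ⟨
      fun h' t                  ∎)

  cunifier⇒kernel-entails : IT E → {x c z : ℕ} {A : List (Eqn Sg (Fin x ⊎ Fin c))}
                            {σ : Fin x → Term Sg (Fin z)} →
                            (K : KernelPresentation σ) → CUnifier E {c = c} A σ →
                            Entails E (map (liftX E) (KernelPresentation.relations K)) A
  cunifier⇒kernel-entails it {x} {c} {z} {σ = σ} K with
    it (TermAlgebra (Fin x) relations) (TermAlgebra (Fin x ⊎ Fin c) (map (liftX E) relations))
       (TermAlgebra (Fin z) []) (substHom (var ∘ inj₁) lift-respects) (substHom σ unifies) reflects
    where
    open KernelPresentation K
    lift-respects : Satisfies (TermAlgebra (Fin x ⊎ Fin c) (map (liftX E) relations)) (var ∘ inj₁) relations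
    lift-respects = All.tabulate λ e∈D → hyp (∈-map⁺ (liftX E) e∈D)
  ... | 𝓔 , h , h' , h'-injective , commutes =
    All.map λ {e} → withParameters-reflects σ h h' (λ j → commutes (var j)) h'-injective (proj₁ e) (proj₂ e)

theorem5p4 : (Sg : Signature) (E : Theory Sg) →
    HasConstant Sg → IT E → Coherent E → ForallFactorizationProperty E →
    (x c : ℕ) (A : List (Eqn Sg (Fin x ⊎ Fin c)))
    (n : ℕ) (B : Fin n → List (Eqn Sg (Fin x))) →
    IsForallFactorization E x c A n B →
    (z : ℕ) (σ : Fin x → Term Sg (Fin z)) →
    CUnifier E {c = c} A σ ⇔ (∃[ i ] Unifier E (B i) σ)
theorem5p4 Sg E _ it coh _ x c A n B (πB≤A , maximal) z σ =
  mk⇔ cunifier⇒unifier (λ (i , σ⊨Bᵢ) → unifier⇒cunifier E (πB≤A i) σ⊨Bᵢ)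
  where
  cunifier⇒unifier : CUnifier E {c = c} A σ → ∃[ i ] Unifier E (B i) σ
  cunifier⇒unifier σ⊨A =
    map₂ (satisfies-entailed E (TermAlgebra E (Fin z) []) σ unifies)
         (maximal relations (cunifier⇒kernel-entails E it K σ⊨A))
    where
    K : KernelPresentation E σ
    K = kernelPresentation E coh σ

    open KernelPresentation K
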